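{- In the level-constrained optimization framework described in the context, after each transformation $\Delta G_i$ is applied, the procedure dynTO updates the sequence $\mathcal{T}$ of unhandled nodes so that it remains a valid partial topological order of the unhandled nodes of the current graph $G_i$; that is, for any two unhandled nodes $m,n$, if there is a path from $m$ to $n$ in $G_i$ then $m$ precedes $n$ in $\mathcal{T}$.
   Context: An AIG is a DAG of primary inputs and 2-input AND nodes. Framework: initially $\mathcal{T}$ is a topological order of $V$ stored as a linked list, and every node is unhandled. Repeatedly, the first node $x$ of $\mathcal{T}$ is marked handled and removed from $\mathcal{T}$; a local transformation may then replace $x$ by a logically equivalent subgraph $\Delta G_i$ rooted at $x'$ whose inputs are the nodes of a $k$-feasible cut of $x$ (a set of at most $k$ nodes through which every path from a primary input to $x$ passes). Applying $\Delta G_i$ ($G_i = G_{i-1}\oplus\Delta G_i$) inserts the new nodes, redirects every fanout edge of $x$ to $x'$, and recursively deletes nodes left without fanouts. Procedure dynTO (run after applying $\Delta G_i$): perform a backward depth-first search from $x'$ over fanin edges, skipping any fanin that is handled or already visited, and append each newly visited fanin to a list $inv$ after its own fanins have been explored (post-order); then, if $x'$ is unhandled, append $x'$ to $inv$. Finally, with an anchor initially at the position that $x$ occupied in the list, for each node $f$ of $inv$ in order, remove $f$ from its current position in $\mathcal{T}$ and reinsert it immediately after the anchor, then move the anchor to $f$. -}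

module Defs where

open import Data.Nat using (ℕ; _≤_; _≟_)
open import Data.Bool using (Bool; true; false; if_then_else_; _xor_; _∧_)
open import Data.Product using (Σ; ∃; ∃₂; _×_; _,_; proj₁; proj₂)
open import Data.Sum using (_⊎_)
open import Data.List using (List; []; _∷_; [_]; _++_; _∷ʳ_; filter; map; length)
open import Data.List.Membership.Propositional using (_∈_; _∉_)
open import Data.List.Membership.DecPropositional _≟_ using (_∈?_; _∉?_)
open import Data.List.Relation.Unary.All using (All)
open import Data.List.Relation.Unary.Unique.Propositional using (Unique)
open import Relation.Binary.PropositionalEquality using (_≡_)
open import Relation.Binary.Construct.Closure.Transitive using (TransClosure)
open import Relation.Binary.Construct.Closure.ReflexiveTransitive using (Star)
open import Relation.Nullary using (¬_; does; ¬?)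

-- A literal is a node id
-- together with a complementation bit (true = inverted edge).

Lit : Set
Lit = ℕ × Bool

data Gate : Set where
  pi  : Gate
  and : Lit → Lit → Gate

fanins : Gate → List ℕ
fanins pi        = []
fanins (and a b) = proj₁ a ∷ proj₁ b ∷ []

mapGate : (Lit → Lit) → Gate → Gate
mapGate f pi        = pi
mapGate f (and a b) = and (f a) (f b)

-- An AIG: the list V of (present) node ids, the gate of every node
-- (only meaningful on V) and the list of primary outputs.
record AIG : Set where
  constructor mkAIG
  field
    V    : List ℕ
    gate : ℕ → Gate
    outs : List Lit
open AIG public

Edge : AIG → ℕ → ℕ → Set
Edge G a b = a ∈ V G × b ∈ V G × a ∈ fanins (gate G b)

Path : AIG → ℕ → ℕ → Set
Path G = TransClosure (Edge G)

Acyclic : AIG → Set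
Acyclic G = ∀ n → ¬ Path G n n

record WF (G : AIG) : Set where
  field
    uniqueV  : Unique (V G)
    faninsIn : ∀ n → n ∈ V G → All (_∈ V G) (fanins (gate G n))
    outsIn   : All (λ l → proj₁ l ∈ V G) (outs G)
    acyclic  : Acyclic G

IsPI : AIG → ℕ → Set
IsPI G p = p ∈ V G × gate G p ≡ pi

data IsAnd : Gate → Set where
  isAnd : ∀ {a b} → IsAnd (and a b)

data Walk (G : AIG) : ℕ → ℕ → List ℕ → Set where
  here : ∀ {n} → n ∈ V G → Walk G n n [ n ]
  step : ∀ {a b c ns} → Edge G a b → Walk G b c ns → Walk G a c (a ∷ ns)

IsCut : AIG → ℕ → List ℕ → Set
IsCut G x C = ∀ p ns → IsPI G p → Walk G p x ns → ∃ λ c → c ∈ ns × c ∈ C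

KFeasibleCut : ℕ → AIG → ℕ → List ℕ → Set
KFeasibleCut k G x C = Unique C × length C ≤ k × All (_∈ V G) C × IsCut G x C

data Eval (G : AIG) (σ : ℕ → Bool) : ℕ → Bool → Set where
  ev-pi  : ∀ {n} → n ∈ V G → gate G n ≡ pi → Eval G σ n (σ n)
  ev-and : ∀ {n a ca b cb va vb} → n ∈ V G →
           gate G n ≡ and (a , ca) (b , cb) →
           Eval G σ a va → Eval G σ b vb →
           Eval G σ n ((va xor ca) ∧ (vb xor cb))

-- ΔG: new AND nodes 'new' (with gates 'newGate') whose inputs are the
-- nodes of 'cut'; root node 'root' with output phase 'phase'
-- (x is replaced by the literal (root , phase)).
record Replacement : Set where
  constructor mkRepl
  field
    cut     : List ℕ
    new     : List ℕ
    newGate : ℕ → Gate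
    root    : ℕ
    phase   : Bool
open Replacement public

-- G together with the inserted nodes of ΔG (before redirection)
union : AIG → Replacement → AIG
union G R = mkAIG (V G ++ new R)
                  (λ n → if does (n ∈? new R) then newGate R n else gate G n)
                  (outs G)

redirect : ℕ → Replacement → Lit → Lit
redirect x R (n , c) = if does (n ≟ x) then (root R , c xor phase R) else (n , c)

-- G ⊕ ΔG before the recursive deletion
plus : AIG → ℕ → Replacement → AIG
plus G x R = mkAIG (V (union G R))
                   (λ n → mapGate (redirect x R) (gate (union G R) n))
                   (map (redirect x R) (outs G))

-- nodes removed by the recursive deletion started at x: x itself, and
-- every AND node (not driving a primary output) that had a fanout among
-- the deleted nodes and all of whose fanouts are deleted.
data Dead (G : AIG) (x : ℕ) : ℕ → Set where
  dead-root    : Dead G x x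
  dead-cascade : ∀ {n m} → IsAnd (gate G n) → n ∉ map proj₁ (outs G) →
                 Edge G n m → Dead G x m →
                 (∀ m′ → Edge G n m′ → Dead G x m′) → Dead G x n

deleteNodes : AIG → List ℕ → AIG
deleteNodes G D = mkAIG (filter (λ n → n ∉? D) (V G)) (gate G) (outs G)

-- validity of a replacement of x in G (T = the remaining list, H = handled)
record ValidReplacement (k : ℕ) (G : AIG) (H T : List ℕ) (x : ℕ)
                        (R : Replacement) : Set where
  field
    cutFeasible : KFeasibleCut k G x (cut R)
    cutNontriv  : x ∉ cut R
    newUnique   : Unique (new R)
    newFresh    : All (λ n → n ∉ V G × n ∉ H × n ∉ T) (new R)
    newAnd      : All (λ n → ∃₂ λ a b → newGate R n ≡ and a b ×
                          proj₁ a ∈ new R ++ cut R × proj₁ b ∈ new R ++ cut R)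
                      (new R)
    rootIn      : root R ∈ new R ++ cut R
    rooted      : All (λ n → Star (Edge (union G R)) n (root R)) (new R)
    equivalent  : ∀ (σ : ℕ → Bool) (b : Bool) →
                    (Eval (union G R) σ x b → Eval (union G R) σ (root R) (b xor phase R))
                  × (Eval (union G R) σ (root R) (b xor phase R) → Eval (union G R) σ x b)
    resultDAG   : Acyclic (plus G x R)

-- backward DFS over fanins, skipping handled or visited nodes;
-- DFS G H vis todo vis′ inv : starting with visited list vis, exploring
-- the nodes todo in order, ends with visited list vis′ and appends inv
-- (post-order).
data DFS (G : AIG) (H : List ℕ) : List ℕ → List ℕ → List ℕ → List ℕ → Set where
  dfs-done  : ∀ {vis} → DFS G H vis [] vis []
  dfs-skip  : ∀ {vis v vs vis′ inv} → (v ∈ H ⊎ v ∈ vis) →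
              DFS G H vis vs vis′ inv → DFS G H vis (v ∷ vs) vis′ inv
  dfs-visit : ∀ {vis v vs vis₁ inv₁ vis₂ inv₂} → v ∉ H → v ∉ vis →
              DFS G H (v ∷ vis) (fanins (gate G v)) vis₁ inv₁ →
              DFS G H vis₁ vs vis₂ inv₂ →
              DFS G H vis (v ∷ vs) vis₂ (inv₁ ++ v ∷ inv₂)

remove : ℕ → List ℕ → List ℕ
remove f = filter (λ y → ¬? (y ≟ f))

-- the list is pre ++ post with the anchor between pre and post;
-- each f is moved to just after the anchor, and the anchor moves to f
reinsert : List ℕ → List ℕ → List ℕ → List ℕ
reinsert pre post []       = pre ++ post
reinsert pre post (f ∷ fs) = reinsert (remove f pre ∷ʳ f) (remove f post) fs

rootIfUnhandled : List ℕ → ℕ → List ℕ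
rootIfUnhandled H x′ = if does (x′ ∈? H) then [] else [ x′ ]

record State : Set where
  constructor ⟨_,_,_⟩
  field
    graph   : AIG
    order   : List ℕ
    handled : List ℕ
open State public

data Step (k : ℕ) : State → State → Set where
  keep    : ∀ {G x rest H} →
            Step k ⟨ G , x ∷ rest , H ⟩ ⟨ G , rest , x ∷ H ⟩
  -- x is handled, ΔG applied (with recursive deletion D), then dynTO
  replace : ∀ {G x rest H} (R : Replacement) (D : List ℕ) {vis inv : List ℕ} →
            ValidReplacement k G (x ∷ H) rest x R →
            (∀ n → (n ∈ D → Dead (plus G x R) x n) × (Dead (plus G x R) x n → n ∈ D)) →
            DFS (deleteNodes (plus G x R) D) (x ∷ H) [ root R ]
                (fanins (gate (plus G x R) (root R))) vis inv →
            Step k ⟨ G , x ∷ rest , H ⟩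
                   ⟨ deleteNodes (plus G x R) D
                   , reinsert [] (filter (λ n → n ∉? D) rest)
                                 (inv ++ rootIfUnhandled (x ∷ H) (root R))
                   , x ∷ H ⟩

Precedes : List ℕ → ℕ → ℕ → Set
Precedes T m n = ∃₂ λ pre post → T ≡ pre ++ m ∷ post × n ∈ post

module Submission where

-- Every reachable state (G, 𝒯, handled) satisfies an invariant: G is closed under fanins,
-- 𝒯 lists the unhandled nodes of G without repetition, the handled nodes are closed under
-- fanins, and every edge between unhandled nodes points forward in 𝒯; forward edges compose
-- to forward paths. Handling the first node x of 𝒯 without a transformation preserves the
-- invariant because no unhandled node can precede x. After a replacement dynTO yields
-- 𝒯′ = L ++ (𝒯 minus x, minus deleted nodes, minus L), where L is the DFS post-order followed
-- by x′ when unhandled. Edges into L are forward since a post-order of the acyclic graph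
-- G ⊕ ΔG lists fanins first; every new node of ΔG lies upstream of x′ and is therefore in L;
-- so an edge into the remaining part of 𝒯′ is an edge of G, or leaves x′, which is in L.

open import Data.Bool using (_xor_)
open import Data.Empty using (⊥-elim)
open import Data.List using (List; []; _∷_; [_]; _++_; _∷ʳ_; filter)
open import Data.List.Properties using (++-assoc; filter-all; filter-accept; filter-reject)
open import Data.List.Membership.Propositional using (_∈_; _∉_)
open import Data.List.Membership.Propositional.Properties using (∈-++⁺ˡ; ∈-++⁺ʳ; ∈-++⁻; ∈-filter⁺; ∈-filter⁻)
open import Data.List.Relation.Binary.Permutation.Propositional using (_↭_; ↭-sym; ↭⇒↭ₛ)
open import Data.List.Relation.Binary.Permutation.Propositional.Properties using (∈-resp-↭)
open import Data.List.Relation.Unary.All using (All; []; _∷_)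
import Data.List.Relation.Unary.All as All
open import Data.List.Relation.Unary.All.Properties using (¬Any⇒All¬)
open import Data.List.Relation.Unary.AllPairs using ([]; _∷_)
open import Data.List.Relation.Unary.Any using (here; there)
open import Data.List.Relation.Unary.Unique.Propositional using (Unique)
open import Data.List.Relation.Unary.Unique.Propositional.Properties using (++⁺; filter⁺)
open import Data.Nat using (ℕ; _≟_)
open import Data.Product using (∃; _×_; _,_; proj₁; proj₂; uncurry)
import Data.Product as Product
open import Data.Sum using (_⊎_; inj₁; inj₂)
import Data.Sum as Sum
open import Function using (_∘_)
open import Relation.Binary.Construct.Closure.ReflexiveTransitive using (Star; ε; _◅_; _◅◅_)
open import Relation.Binary.Construct.Closure.Transitive using (TransClosure) renaming ([_] to ⁺[_]; _∷_ to _⁺∷_)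
open import Relation.Binary.PropositionalEquality using (_≡_; refl; sym; trans; cong; subst; setoid)
open Relation.Binary.PropositionalEquality.≡-Reasoning
open import Relation.Nullary using (¬_; Dec; yes; no; ¬?)
open import Relation.Nullary.Decidable using (dec-true; dec-false; toSum)
open import Relation.Unary using (Pred; Decidable)

open import Defs
open import Data.List.Membership.DecPropositional _≟_ using (_∈?_; _∉?_)
open import Data.List.Relation.Binary.Permutation.Setoid.Properties (setoid ℕ) using (Unique-resp-↭)

precedes-head : ∀ {a b xs} → b ∈ xs → Precedes (a ∷ xs) a b
precedes-head {xs = xs} b∈xs = [] , xs , refl , b∈xs

precedes-∷ : ∀ {y a b xs} → Precedes xs a b → Precedes (y ∷ xs) a b
precedes-∷ {y} (pre , post , refl , b∈post) = y ∷ pre , post , refl , b∈post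

precedes-∷⁻ : ∀ {y a b xs} → Precedes (y ∷ xs) a b → (y ≡ a × b ∈ xs) ⊎ Precedes xs a b
precedes-∷⁻ ([]    , post , refl , b∈post) = inj₁ (refl , b∈post)
precedes-∷⁻ (_ ∷ pre , post , refl , b∈post) = inj₂ (pre , post , refl , b∈post)

precedes⇒∈ : ∀ {a b xs} → Precedes xs a b → a ∈ xs × b ∈ xs
precedes⇒∈ (pre , post , refl , b∈post) = ∈-++⁺ʳ pre (here refl) , ∈-++⁺ʳ pre (there b∈post)

precedes-[] : ∀ {a b} → ¬ Precedes [] a b
precedes-[] ([]    , _ , () , _)
precedes-[] (_ ∷ _ , _ , () , _)

precedes-trans : ∀ {a b c xs} → Unique xs → Precedes xs a b → Precedes xs b c → Precedes xs a c
precedes-trans {xs = []} _ p _ = ⊥-elim (precedes-[] p)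
precedes-trans {xs = y ∷ xs} (y∉xs ∷ u) p q with precedes-∷⁻ p | precedes-∷⁻ q
... | inj₁ (refl , b∈xs) | inj₁ (refl , _) = ⊥-elim (All.lookup y∉xs b∈xs refl)
... | inj₁ (refl , _)    | inj₂ q′         = precedes-head (proj₂ (precedes⇒∈ q′))
... | inj₂ p′            | inj₁ (refl , _) = ⊥-elim (All.lookup y∉xs (proj₂ (precedes⇒∈ p′)) refl)
... | inj₂ p′            | inj₂ q′         = precedes-∷ (precedes-trans u p′ q′)

precedes-++⁺ˡ : ∀ {a b} xs ys → Precedes xs a b → Precedes (xs ++ ys) a b
precedes-++⁺ˡ xs ys (pre , post , refl , b∈post) = pre , post ++ ys , ++-assoc pre _ ys , ∈-++⁺ˡ b∈post

precedes-++⁺ʳ : ∀ {a b} xs ys → Precedes ys a b → Precedes (xs ++ ys) a b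
precedes-++⁺ʳ []       ys p = p
precedes-++⁺ʳ (x ∷ xs) ys p = precedes-∷ (precedes-++⁺ʳ xs ys p)

precedes-++⁺ : ∀ {a b} xs ys → a ∈ xs → b ∈ ys → Precedes (xs ++ ys) a b
precedes-++⁺ (x ∷ xs) ys (here refl) b∈ys = precedes-head (∈-++⁺ʳ xs b∈ys)
precedes-++⁺ (x ∷ xs) ys (there a∈xs) b∈ys = precedes-∷ (precedes-++⁺ xs ys a∈xs b∈ys)

precedes-filter⁺ : ∀ {p} {P : Pred ℕ p} (P? : Decidable P) {a b} xs →
                   Precedes xs a b → P a → P b → Precedes (filter P? xs) a b
precedes-filter⁺ P? [] p _ _ = ⊥-elim (precedes-[] p)
precedes-filter⁺ P? (y ∷ xs) p pa pb with precedes-∷⁻ p | P? y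
... | inj₁ (refl , b∈xs) | yes _  = precedes-head (∈-filter⁺ P? b∈xs pb)
... | inj₁ (refl , _)    | no ¬pa = ⊥-elim (¬pa pa)
... | inj₂ p′            | yes _  = precedes-∷ (precedes-filter⁺ P? xs p′ pa pb)
... | inj₂ p′            | no _   = precedes-filter⁺ P? xs p′ pa pb

∉-∷⁺ : ∀ {y f : ℕ} {fs} → ¬ y ≡ f → y ∉ fs → y ∉ f ∷ fs
∉-∷⁺ y≢f _     (here y≡f)   = y≢f y≡f
∉-∷⁺ _   y∉fs (there y∈fs) = y∉fs y∈fs

∉-∷⁻ : ∀ {y f : ℕ} {fs} → y ∉ f ∷ fs → y ∉ fs
∉-∷⁻ y∉ = y∉ ∘ there

∉-∷ʳ : ∀ {y f : ℕ} {fs} → ¬ f ≡ y → y ∉ fs → y ∉ fs ∷ʳ f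
∉-∷ʳ {fs = fs} f≢y y∉fs y∈ with ∈-++⁻ fs y∈
... | inj₁ y∈fs        = y∉fs y∈fs
... | inj₂ (here refl) = f≢y refl

remove-head : ∀ y xs → remove y (y ∷ xs) ≡ remove y xs
remove-head y xs = filter-reject (λ z → ¬? (z ≟ y)) (λ y≢y → y≢y refl)

remove-∷ : ∀ {y f} xs → ¬ y ≡ f → remove f (y ∷ xs) ≡ y ∷ remove f xs
remove-∷ {f = f} xs = filter-accept (λ z → ¬? (z ≟ f))

remove-absent : ∀ {f} xs → f ∉ xs → remove f xs ≡ xs
remove-absent {f} xs f∉xs =
  filter-all (λ z → ¬? (z ≟ f)) (All.map (λ f≢z z≡f → f≢z (sym z≡f)) (¬Any⇒All¬ xs f∉xs))

filter-∉-remove : ∀ f fs post → filter (_∉? fs) (remove f post) ≡ filter (_∉? (f ∷ fs)) post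
filter-∉-remove f fs []         = refl
filter-∉-remove f fs (y ∷ post) with y ≟ f
... | yes refl = begin
  filter (_∉? fs) (remove y (y ∷ post)) ≡⟨ cong (filter (_∉? fs)) (remove-head y post) ⟩
  filter (_∉? fs) (remove y post)       ≡⟨ filter-∉-remove y fs post ⟩
  filter (_∉? (y ∷ fs)) post            ≡⟨ filter-reject (_∉? (y ∷ fs)) (λ y∉ → y∉ (here refl)) ⟨
  filter (_∉? (y ∷ fs)) (y ∷ post)      ∎
... | no y≢f = trans (cong (filter (_∉? fs)) (remove-∷ post y≢f)) (kept (y ∈? fs))
  where
  kept : Dec (y ∈ fs) → filter (_∉? fs) (y ∷ remove f post) ≡ filter (_∉? (f ∷ fs)) (y ∷ post)
  kept (yes y∈fs) = begin
    filter (_∉? fs) (y ∷ remove f post) ≡⟨ filter-reject (_∉? fs) (λ y∉ → y∉ y∈fs) ⟩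
    filter (_∉? fs) (remove f post)     ≡⟨ filter-∉-remove f fs post ⟩
    filter (_∉? (f ∷ fs)) post          ≡⟨ filter-reject (_∉? (f ∷ fs)) (λ y∉ → y∉ (there y∈fs)) ⟨
    filter (_∉? (f ∷ fs)) (y ∷ post)    ∎
  kept (no y∉fs) = begin
    filter (_∉? fs) (y ∷ remove f post) ≡⟨ filter-accept (_∉? fs) y∉fs ⟩
    y ∷ filter (_∉? fs) (remove f post) ≡⟨ cong (y ∷_) (filter-∉-remove f fs post) ⟩
    y ∷ filter (_∉? (f ∷ fs)) post      ≡⟨ filter-accept (_∉? (f ∷ fs)) (∉-∷⁺ y≢f y∉fs) ⟨
    filter (_∉? (f ∷ fs)) (y ∷ post)    ∎

reinsert-≡ : ∀ pre post fs → Unique fs → All (_∉ pre) fs →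
             reinsert pre post fs ≡ pre ++ fs ++ filter (_∉? fs) post
reinsert-≡ pre post [] _ _ = cong (pre ++_) (sym (filter-all (_∉? []) (All.tabulate (λ _ ()))))
reinsert-≡ pre post (f ∷ fs) (f∉fs ∷ u) (f∉pre ∷ fs∉pre) = begin
  reinsert (remove f pre ∷ʳ f) (remove f post) fs
    ≡⟨ cong (λ p → reinsert (p ∷ʳ f) _ fs) (remove-absent pre f∉pre) ⟩
  reinsert (pre ∷ʳ f) (remove f post) fs
    ≡⟨ reinsert-≡ (pre ∷ʳ f) _ fs u (All.zipWith (uncurry ∉-∷ʳ) (f∉fs , fs∉pre)) ⟩
  (pre ∷ʳ f) ++ fs ++ filter (_∉? fs) (remove f post)
    ≡⟨ cong (λ q → (pre ∷ʳ f) ++ fs ++ q) (filter-∉-remove f fs post) ⟩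
  (pre ∷ʳ f) ++ fs ++ filter (_∉? (f ∷ fs)) post
    ≡⟨ ++-assoc pre [ f ] _ ⟩
  pre ++ (f ∷ fs) ++ filter (_∉? (f ∷ fs)) post
    ∎

Fanin : AIG → ℕ → ℕ → Set
Fanin G a b = a ∈ fanins (gate G b)

∈-++-∷⁻ : ∀ {y v : ℕ} xs {ys} → y ∈ xs ++ v ∷ ys → y ∈ xs ⊎ y ≡ v ⊎ y ∈ ys
∈-++-∷⁻ xs y∈ with ∈-++⁻ xs y∈
... | inj₁ y∈xs         = inj₁ y∈xs
... | inj₂ (here y≡v)   = inj₂ (inj₁ y≡v)
... | inj₂ (there y∈ys) = inj₂ (inj₂ y∈ys)

_◅⁺_ : ∀ {R : ℕ → ℕ → Set} {a b c} → R a b → Star R b c → TransClosure R a c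
r ◅⁺ ε        = ⁺[ r ]
r ◅⁺ (s ◅ ss) = r ⁺∷ (s ◅⁺ ss)

-- Gates of nodes outside V G are junk and may form cycles, so acyclicity is only
-- assumed for the region the search can reach.
CycleFreeUpstream : AIG → List ℕ → Set
CycleFreeUpstream G todo = ∀ {n t} → t ∈ todo → Star (Fanin G) n t → ¬ TransClosure (Fanin G) n n

module _ {G : AIG} {H : List ℕ} where

  dfs-visited-mono : ∀ {vis todo vis′ inv y} → DFS G H vis todo vis′ inv → y ∈ vis → y ∈ vis′
  dfs-visited-mono dfs-done             y∈ = y∈
  dfs-visited-mono (dfs-skip _ d)       y∈ = dfs-visited-mono d y∈
  dfs-visited-mono (dfs-visit _ _ d₁ d₂) y∈ = dfs-visited-mono d₂ (dfs-visited-mono d₁ (there y∈))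

  dfs-inv⊆visited : ∀ {vis todo vis′ inv y} → DFS G H vis todo vis′ inv → y ∈ inv → y ∈ vis′
  dfs-inv⊆visited (dfs-skip _ d) y∈ = dfs-inv⊆visited d y∈
  dfs-inv⊆visited (dfs-visit {inv₁ = inv₁} _ _ d₁ d₂) y∈ with ∈-++-∷⁻ inv₁ y∈
  ... | inj₁ y∈inv₁        = dfs-visited-mono d₂ (dfs-inv⊆visited d₁ y∈inv₁)
  ... | inj₂ (inj₁ refl)   = dfs-visited-mono d₂ (dfs-visited-mono d₁ (here refl))
  ... | inj₂ (inj₂ y∈inv₂) = dfs-inv⊆visited d₂ y∈inv₂

  dfs-visited⊆ : ∀ {vis todo vis′ inv y} → DFS G H vis todo vis′ inv → y ∈ vis′ → y ∈ vis ⊎ y ∈ inv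
  dfs-visited⊆ dfs-done       y∈ = inj₁ y∈
  dfs-visited⊆ (dfs-skip _ d) y∈ = dfs-visited⊆ d y∈
  dfs-visited⊆ (dfs-visit {inv₁ = inv₁} _ _ d₁ d₂) y∈ with dfs-visited⊆ d₂ y∈
  ... | inj₂ y∈inv₂ = inj₂ (∈-++⁺ʳ inv₁ (there y∈inv₂))
  ... | inj₁ y∈vis₁ with dfs-visited⊆ d₁ y∈vis₁
  ...   | inj₁ (here refl)  = inj₂ (∈-++⁺ʳ inv₁ (here refl))
  ...   | inj₁ (there y∈vis) = inj₁ y∈vis
  ...   | inj₂ y∈inv₁        = inj₂ (∈-++⁺ˡ y∈inv₁)

  dfs-inv-unhandled : ∀ {vis todo vis′ inv y} → DFS G H vis todo vis′ inv → y ∈ inv → y ∉ H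
  dfs-inv-unhandled (dfs-skip _ d) y∈ = dfs-inv-unhandled d y∈
  dfs-inv-unhandled (dfs-visit {inv₁ = inv₁} v∉H _ d₁ d₂) y∈ with ∈-++-∷⁻ inv₁ y∈
  ... | inj₁ y∈inv₁        = dfs-inv-unhandled d₁ y∈inv₁
  ... | inj₂ (inj₁ refl)   = v∉H
  ... | inj₂ (inj₂ y∈inv₂) = dfs-inv-unhandled d₂ y∈inv₂

  dfs-inv-fresh : ∀ {vis todo vis′ inv y} → DFS G H vis todo vis′ inv → y ∈ inv → y ∉ vis
  dfs-inv-fresh (dfs-skip _ d) y∈ = dfs-inv-fresh d y∈
  dfs-inv-fresh (dfs-visit {inv₁ = inv₁} _ v∉vis d₁ d₂) y∈ with ∈-++-∷⁻ inv₁ y∈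
  ... | inj₁ y∈inv₁        = λ y∈vis → dfs-inv-fresh d₁ y∈inv₁ (there y∈vis)
  ... | inj₂ (inj₁ refl)   = v∉vis
  ... | inj₂ (inj₂ y∈inv₂) = λ y∈vis → dfs-inv-fresh d₂ y∈inv₂ (dfs-visited-mono d₁ (there y∈vis))

  dfs-inv-unique : ∀ {vis todo vis′ inv} → DFS G H vis todo vis′ inv → Unique inv
  dfs-inv-unique dfs-done       = []
  dfs-inv-unique (dfs-skip _ d) = dfs-inv-unique d
  dfs-inv-unique (dfs-visit {v = v} {inv₁ = inv₁} {inv₂ = inv₂} _ _ d₁ d₂) =
    ++⁺ (dfs-inv-unique d₁) (All.tabulate v∉inv₂ ∷ dfs-inv-unique d₂) disjoint
    where
    v∉inv₂ : ∀ {y} → y ∈ inv₂ → ¬ v ≡ y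
    v∉inv₂ y∈inv₂ refl = dfs-inv-fresh d₂ y∈inv₂ (dfs-visited-mono d₁ (here refl))
    disjoint : ∀ {y} → ¬ (y ∈ inv₁ × y ∈ v ∷ inv₂)
    disjoint (y∈inv₁ , here refl)     = dfs-inv-fresh d₁ y∈inv₁ (here refl)
    disjoint (y∈inv₁ , there y∈inv₂) = dfs-inv-fresh d₂ y∈inv₂ (dfs-inv⊆visited d₁ y∈inv₁)

  dfs-todo-explored : ∀ {vis todo vis′ inv t} → DFS G H vis todo vis′ inv → t ∈ todo → t ∈ H ⊎ t ∈ vis′
  dfs-todo-explored (dfs-skip skipped d) (here refl) = Sum.map₂ (dfs-visited-mono d) skipped
  dfs-todo-explored (dfs-skip _ d)       (there t∈)  = dfs-todo-explored d t∈
  dfs-todo-explored (dfs-visit _ _ d₁ d₂) (here refl) =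
    inj₂ (dfs-visited-mono d₂ (dfs-visited-mono d₁ (here refl)))
  dfs-todo-explored (dfs-visit _ _ d₁ d₂) (there t∈)  = dfs-todo-explored d₂ t∈

  dfs-fanins-explored : ∀ {vis todo vis′ inv b w} → DFS G H vis todo vis′ inv →
                        b ∈ inv → Fanin G w b → w ∈ H ⊎ w ∈ vis′
  dfs-fanins-explored (dfs-skip _ d) b∈ w↝b = dfs-fanins-explored d b∈ w↝b
  dfs-fanins-explored (dfs-visit {inv₁ = inv₁} _ _ d₁ d₂) b∈ w↝b with ∈-++-∷⁻ inv₁ b∈
  ... | inj₁ b∈inv₁        = Sum.map₂ (dfs-visited-mono d₂) (dfs-fanins-explored d₁ b∈inv₁ w↝b)
  ... | inj₂ (inj₁ refl)   = Sum.map₂ (dfs-visited-mono d₂) (dfs-todo-explored d₁ w↝b)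
  ... | inj₂ (inj₂ b∈inv₂) = dfs-fanins-explored d₂ b∈inv₂ w↝b

  dfs-inv-reaches-todo : ∀ {vis todo vis′ inv b} → DFS G H vis todo vis′ inv →
                         b ∈ inv → ∃ λ t → t ∈ todo × Star (Fanin G) b t
  dfs-inv-reaches-todo (dfs-skip _ d) b∈ with dfs-inv-reaches-todo d b∈
  ... | t , t∈ , b↝t = t , there t∈ , b↝t
  dfs-inv-reaches-todo (dfs-visit {inv₁ = inv₁} _ _ d₁ d₂) b∈ with ∈-++-∷⁻ inv₁ b∈
  ... | inj₁ b∈inv₁ with dfs-inv-reaches-todo d₁ b∈inv₁
  ...   | t , t↝v , b↝t = _ , here refl , b↝t ◅◅ (t↝v ◅ ε)
  dfs-inv-reaches-todo (dfs-visit _ _ _ _) _ | inj₂ (inj₁ refl) = _ , here refl , ε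
  dfs-inv-reaches-todo (dfs-visit _ _ _ d₂) _ | inj₂ (inj₂ b∈inv₂) with dfs-inv-reaches-todo d₂ b∈inv₂
  ... | t , t∈ , b↝t = t , there t∈ , b↝t

  dfs-inv-topological : ∀ {vis todo vis′ inv b w} → CycleFreeUpstream G todo → DFS G H vis todo vis′ inv →
                        b ∈ inv → w ∈ inv → Fanin G w b → Precedes inv w b
  dfs-inv-topological acyclic (dfs-skip _ d) = dfs-inv-topological (acyclic ∘ there) d
  dfs-inv-topological {b = b} {w} acyclic
                      (dfs-visit {v = v} {vis₁ = vis₁} {inv₁ = inv₁} {inv₂ = inv₂} _ _ d₁ d₂) b∈ w∈ w↝b =
    by-position (∈-++-∷⁻ inv₁ b∈) (∈-++-∷⁻ inv₁ w∈)
    where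
    acyclic₁ : CycleFreeUpstream G (fanins (gate G v))
    acyclic₁ t↝v n↝t = acyclic (here refl) (n↝t ◅◅ (t↝v ◅ ε))
    v-on-cycle : ¬ TransClosure (Fanin G) v v
    v-on-cycle = acyclic (here refl) ε
    inv₁-below-v : ∀ {y} → y ∈ inv₁ → Star (Fanin G) y v
    inv₁-below-v y∈inv₁ with dfs-inv-reaches-todo d₁ y∈inv₁
    ... | _ , t↝v , y↝t = y↝t ◅◅ (t↝v ◅ ε)
    unexplored : ∀ {y} → y ∈ inv₂ → ¬ (y ∈ H ⊎ y ∈ vis₁)
    unexplored y∈inv₂ (inj₁ y∈H)    = dfs-inv-unhandled d₂ y∈inv₂ y∈H
    unexplored y∈inv₂ (inj₂ y∈vis₁) = dfs-inv-fresh d₂ y∈inv₂ y∈vis₁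
    by-position : b ∈ inv₁ ⊎ b ≡ v ⊎ b ∈ inv₂ → w ∈ inv₁ ⊎ w ≡ v ⊎ w ∈ inv₂ →
                  Precedes (inv₁ ++ v ∷ inv₂) w b
    by-position (inj₁ b∈inv₁) (inj₁ w∈inv₁) =
      precedes-++⁺ˡ inv₁ _ (dfs-inv-topological acyclic₁ d₁ b∈inv₁ w∈inv₁ w↝b)
    by-position (inj₁ b∈inv₁) (inj₂ (inj₁ refl))   = ⊥-elim (v-on-cycle (w↝b ◅⁺ inv₁-below-v b∈inv₁))
    by-position (inj₁ b∈inv₁) (inj₂ (inj₂ w∈inv₂)) =
      ⊥-elim (unexplored w∈inv₂ (dfs-fanins-explored d₁ b∈inv₁ w↝b))
    by-position (inj₂ (inj₁ refl)) (inj₁ w∈inv₁)        = precedes-++⁺ inv₁ _ w∈inv₁ (here refl)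
    by-position (inj₂ (inj₁ refl)) (inj₂ (inj₁ refl))   = ⊥-elim (v-on-cycle ⁺[ w↝b ])
    by-position (inj₂ (inj₁ refl)) (inj₂ (inj₂ w∈inv₂)) =
      ⊥-elim (unexplored w∈inv₂ (dfs-todo-explored d₁ w↝b))
    by-position (inj₂ (inj₂ b∈inv₂)) (inj₁ w∈inv₁)        = precedes-++⁺ inv₁ _ w∈inv₁ (there b∈inv₂)
    by-position (inj₂ (inj₂ b∈inv₂)) (inj₂ (inj₁ refl))   = precedes-++⁺ʳ inv₁ _ (precedes-head b∈inv₂)
    by-position (inj₂ (inj₂ b∈inv₂)) (inj₂ (inj₂ w∈inv₂)) =
      precedes-++⁺ʳ inv₁ _ (precedes-∷ (dfs-inv-topological (acyclic ∘ there) d₂ b∈inv₂ w∈inv₂ w↝b))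

redirect-target : ∀ x R c → redirect x R (x , c) ≡ (root R , c xor phase R)
redirect-target x R c rewrite dec-true (x ≟ x) refl = refl

redirect-other : ∀ x R {n} c → ¬ n ≡ x → redirect x R (n , c) ≡ (n , c)
redirect-other x R c n≢x rewrite dec-false (_ ≟ x) n≢x = refl

≡-redirect⁻ : ∀ x R {a} (l : Lit) → a ≡ proj₁ (redirect x R l) →
              (a ≡ root R × x ≡ proj₁ l) ⊎ (¬ a ≡ x × a ≡ proj₁ l)
≡-redirect⁻ x R (n , c) a≡ with n ≟ x
... | yes refl rewrite redirect-target n R c = inj₁ (a≡ , refl)
... | no n≢x   rewrite redirect-other x R c n≢x = inj₂ ((λ a≡x → n≢x (trans (sym a≡) a≡x)) , a≡)

fanins-redirect⁻ : ∀ x R g {a} → a ∈ fanins (mapGate (redirect x R) g) →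
                   (a ≡ root R × x ∈ fanins g) ⊎ (¬ a ≡ x × a ∈ fanins g)
fanins-redirect⁻ x R (and l₁ l₂) (here a≡) =
  Sum.map (Product.map₂ here) (Product.map₂ here) (≡-redirect⁻ x R l₁ a≡)
fanins-redirect⁻ x R (and l₁ l₂) (there (here a≡)) =
  Sum.map (Product.map₂ (there ∘ here)) (Product.map₂ (there ∘ here)) (≡-redirect⁻ x R l₂ a≡)

fanins-redirect⁺ : ∀ x R g {a} → a ∈ fanins g → ¬ a ≡ x → a ∈ fanins (mapGate (redirect x R) g)
fanins-redirect⁺ x R (and (_ , c) _) (here refl) a≢x rewrite redirect-other x R c a≢x = here refl
fanins-redirect⁺ x R (and _ (_ , c)) (there (here refl)) a≢x rewrite redirect-other x R c a≢x = there (here refl)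

gate-union-new : ∀ G R {n} → n ∈ new R → gate (union G R) n ≡ newGate R n
gate-union-new G R {n} n∈new rewrite dec-true (n ∈? new R) n∈new = refl

gate-union-old : ∀ G R {n} → n ∉ new R → gate (union G R) n ≡ gate G n
gate-union-old G R {n} n∉new rewrite dec-false (n ∈? new R) n∉new = refl

record Invariant (s : State) : Set where
  field
    fanin-closed      : ∀ {n w} → n ∈ V (graph s) → Fanin (graph s) w n → w ∈ V (graph s)
    order-unique      : Unique (order s)
    order-unhandled   : ∀ {n} → n ∈ order s → n ∉ handled s
    unhandled-ordered : ∀ {n} → n ∈ V (graph s) → n ∉ handled s → n ∈ order s
    fanout-unhandled  : ∀ {a b} → Edge (graph s) a b → a ∉ handled s → b ∉ handled s
    edge-ordered      : ∀ {a b} → Edge (graph s) a b → a ∉ handled s → b ∉ handled s →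
                        Precedes (order s) a b

invariant-initial : ∀ {G₀ T₀} → WF G₀ → T₀ ↭ V G₀ → (∀ m n → Path G₀ m n → Precedes T₀ m n) →
                    Invariant ⟨ G₀ , T₀ , [] ⟩
invariant-initial wf T₀↭V ordered = record
  { fanin-closed      = λ n∈V w↝n → All.lookup (faninsIn _ n∈V) w↝n
  ; order-unique      = Unique-resp-↭ (↭⇒↭ₛ (↭-sym T₀↭V)) uniqueV
  ; order-unhandled   = λ _ ()
  ; unhandled-ordered = λ n∈V _ → ∈-resp-↭ (↭-sym T₀↭V) n∈V
  ; fanout-unhandled  = λ _ _ ()
  ; edge-ordered      = λ e _ _ → ordered _ _ ⁺[ e ]
  }
  where open WF wf

module _ {G x rest H} (I : Invariant ⟨ G , x ∷ rest , H ⟩) where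
  open Invariant I

  head-unhandled : x ∉ H
  head-unhandled = order-unhandled (here refl)

  head∉rest : x ∉ rest
  head∉rest with order-unique
  ... | x∉rest ∷ _ = λ x∈rest → All.lookup x∉rest x∈rest refl

  rest-unique : Unique rest
  rest-unique with order-unique
  ... | _ ∷ u = u

  rest-unhandled : ∀ {n} → n ∈ rest → n ∉ x ∷ H
  rest-unhandled n∈rest (here refl) = head∉rest n∈rest
  rest-unhandled n∈rest (there n∈H) = order-unhandled (there n∈rest) n∈H

  unhandled-in-rest : ∀ {n} → n ∈ V G → n ∉ x ∷ H → n ∈ rest
  unhandled-in-rest n∈V n∉H with unhandled-ordered n∈V (∉-∷⁻ n∉H)
  ... | here refl    = ⊥-elim (n∉H (here refl))
  ... | there n∈rest = n∈rest

  edge-ordered-rest : ∀ {a b} → Edge G a b → ¬ a ≡ x → a ∉ H → b ∉ H → Precedes rest a b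
  edge-ordered-rest e a≢x a∉H b∉H with precedes-∷⁻ (edge-ordered e a∉H b∉H)
  ... | inj₁ (x≡a , _) = ⊥-elim (a≢x (sym x≡a))
  ... | inj₂ a≺b       = a≺b

  invariant-keep : Invariant ⟨ G , rest , x ∷ H ⟩
  invariant-keep = record
    { fanin-closed      = fanin-closed
    ; order-unique      = rest-unique
    ; order-unhandled   = rest-unhandled
    ; unhandled-ordered = unhandled-in-rest
    ; fanout-unhandled  = fanout-unhandled′
    ; edge-ordered      = λ e a∉H b∉H → edge-ordered-rest e (a∉H ∘ here) (∉-∷⁻ a∉H) (∉-∷⁻ b∉H)
    }
    where
    fanout-unhandled′ : ∀ {a b} → Edge G a b → a ∉ x ∷ H → b ∉ x ∷ H
    fanout-unhandled′ e a∉H (there b∈H)  = fanout-unhandled e (∉-∷⁻ a∉H) b∈H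
    fanout-unhandled′ e a∉H (here refl) =
      head∉rest (proj₂ (precedes⇒∈ (edge-ordered-rest e (a∉H ∘ here) (∉-∷⁻ a∉H) head-unhandled)))

∈-rootIfUnhandled⁻ : ∀ H r {y} → y ∈ rootIfUnhandled H r → y ≡ r × y ∉ H
∈-rootIfUnhandled⁻ H r y∈ with r ∈? H
∈-rootIfUnhandled⁻ H r ()          | yes _
∈-rootIfUnhandled⁻ H r (here refl) | no r∉H = refl , r∉H

∈-rootIfUnhandled⁺ : ∀ {H r} → r ∉ H → r ∈ rootIfUnhandled H r
∈-rootIfUnhandled⁺ {H} {r} r∉H rewrite dec-false (r ∈? H) r∉H = here refl

rootIfUnhandled-unique : ∀ H r → Unique (rootIfUnhandled H r)
rootIfUnhandled-unique H r with r ∈? H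
... | yes _ = []
... | no _  = [] ∷ []

module ReplacementStep {k G x rest H} (R : Replacement) (D : List ℕ) {vis inv : List ℕ}
  (valid : ValidReplacement k G (x ∷ H) rest x R)
  (dead : ∀ n → (n ∈ D → Dead (plus G x R) x n) × (Dead (plus G x R) x n → n ∈ D))
  (dfs : DFS (deleteNodes (plus G x R) D) (x ∷ H) [ root R ] (fanins (gate (plus G x R) (root R))) vis inv)
  (I : Invariant ⟨ G , x ∷ rest , H ⟩) where

  open ValidReplacement valid
  open Invariant I

  U G′ : AIG
  U  = plus G x R
  G′ = deleteNodes U D

  H′ : List ℕ
  H′ = x ∷ H

  r : ℕ
  r = root R

  new∉G : ∀ {n} → n ∈ new R → n ∉ V G
  new∉G = proj₁ ∘ All.lookup newFresh

  new-unhandled : ∀ {n} → n ∈ new R → n ∉ H′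
  new-unhandled = proj₁ ∘ proj₂ ∘ All.lookup newFresh

  ∈G′⁻ : ∀ {y} → y ∈ V G′ → y ∈ V U × y ∉ D
  ∈G′⁻ = ∈-filter⁻ (_∉? D)

  ∈U-old : ∀ {y} → y ∈ V U → y ∉ new R → y ∈ V G
  ∈U-old y∈U y∉new with ∈-++⁻ (V G) y∈U
  ... | inj₁ y∈G   = y∈G
  ... | inj₂ y∈new = ⊥-elim (y∉new y∈new)

  new++cut⊆U : ∀ {y} → y ∈ new R ++ cut R → y ∈ V U
  new++cut⊆U y∈ with ∈-++⁻ (new R) y∈
  ... | inj₁ y∈new = ∈-++⁺ʳ (V G) y∈new
  ... | inj₂ y∈cut = ∈-++⁺ˡ (All.lookup (proj₁ (proj₂ (proj₂ cutFeasible))) y∈cut)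

  root∈U : r ∈ V U
  root∈U = new++cut⊆U rootIn

  root≢x : ¬ r ≡ x
  root≢x refl with ∈-++⁻ (new R) rootIn
  ... | inj₁ x∈new = new-unhandled x∈new (here refl)
  ... | inj₂ x∈cut = cutNontriv x∈cut

  x∈D : x ∈ D
  x∈D = proj₂ (dead x) dead-root

  fanin-old : ∀ {n w} → n ∉ new R → Fanin (union G R) w n → Fanin G w n
  fanin-old {w = w} n∉new = subst (λ g → w ∈ fanins g) (gate-union-old G R n∉new)

  new? : ∀ n → n ∈ new R ⊎ n ∉ new R
  new? n = toSum (n ∈? new R)

  fanin-new : ∀ {n w} → n ∈ new R → Fanin (union G R) w n → w ∈ new R ++ cut R
  fanin-new {n} {w} n∈new w↝n
    with All.lookup newAnd n∈new | subst (λ g → w ∈ fanins g) (gate-union-new G R n∈new) w↝n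
  ... | a , b , gate≡ , a∈ , b∈ | w↝n′ rewrite gate≡ with w↝n′
  ...   | here refl         = a∈
  ...   | there (here refl) = b∈

  U-fanin-closed : ∀ {n w} → n ∈ V U → Fanin U w n → w ∈ V U
  U-fanin-closed {n} n∈U w↝n with fanins-redirect⁻ x R (gate (union G R) n) w↝n
  ... | inj₁ (refl , _) = root∈U
  ... | inj₂ (_ , w↝n′) with new? n
  ...   | inj₁ n∈new = new++cut⊆U (fanin-new n∈new w↝n′)
  ...   | inj₂ n∉new = ∈-++⁺ˡ (fanin-closed (∈U-old n∈U n∉new) (fanin-old n∉new w↝n′))

  fanin-path : ∀ {a c} → TransClosure (Fanin U) a c → c ∈ V U → a ∈ V U × Path U a c
  fanin-path ⁺[ a↝c ] c∈U = let a∈U = U-fanin-closed c∈U a↝c in a∈U , ⁺[ a∈U , c∈U , a↝c ]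
  fanin-path (a↝b ⁺∷ b↝⁺c) c∈U with fanin-path b↝⁺c c∈U
  ... | b∈U , b⇝c = let a∈U = U-fanin-closed b∈U a↝b in a∈U , (a∈U , b∈U , a↝b) ⁺∷ b⇝c

  upstream-∈U : ∀ {n c} → Star (Fanin U) n c → c ∈ V U → n ∈ V U
  upstream-∈U ε                c∈U = c∈U
  upstream-∈U (n↝m ◅ m↝⋆c) c∈U = U-fanin-closed (upstream-∈U m↝⋆c c∈U) n↝m

  U-acyclic : ∀ {n} → n ∈ V U → ¬ TransClosure (Fanin U) n n
  U-acyclic n∈U n↝⁺n = resultDAG _ (proj₂ (fanin-path n↝⁺n n∈U))

  root-acyclic : ¬ TransClosure (Fanin U) r r
  root-acyclic = U-acyclic root∈U

  dfs-cycle-free : CycleFreeUpstream G′ (fanins (gate U r))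
  dfs-cycle-free t↝r n↝⋆t = U-acyclic (upstream-∈U n↝⋆t (U-fanin-closed root∈U t↝r))

  inv-upstream : ∀ {b} → b ∈ inv → Star (Fanin U) b r
  inv-upstream b∈inv with dfs-inv-reaches-todo dfs b∈inv
  ... | _ , t↝r , b↝⋆t = b↝⋆t ◅◅ (t↝r ◅ ε)

  visited⁻ : ∀ {y} → y ∈ vis → y ≡ r ⊎ y ∈ inv
  visited⁻ y∈vis with dfs-visited⊆ dfs y∈vis
  ... | inj₁ (here y≡r) = inj₁ y≡r
  ... | inj₂ y∈inv      = inj₂ y∈inv

  visited-explored : ∀ {y w} → y ∈ vis → Fanin U w y → w ∈ H′ ⊎ w ∈ vis
  visited-explored y∈vis w↝y with visited⁻ y∈vis
  ... | inj₁ refl  = dfs-todo-explored dfs w↝y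
  ... | inj₂ y∈inv = dfs-fanins-explored dfs y∈inv w↝y

  L : List ℕ
  L = inv ++ rootIfUnhandled H′ r

  ∈L⁻ : ∀ {y} → y ∈ L → y ∈ inv ⊎ (y ≡ r × y ∉ H′)
  ∈L⁻ y∈L = Sum.map₂ (∈-rootIfUnhandled⁻ H′ r) (∈-++⁻ inv y∈L)

  root∈L : r ∉ H′ → r ∈ L
  root∈L r∉H′ = ∈-++⁺ʳ inv (∈-rootIfUnhandled⁺ r∉H′)

  visited⊆L : ∀ {y} → y ∈ vis → y ∉ H′ → y ∈ L
  visited⊆L y∈vis y∉H′ with visited⁻ y∈vis
  ... | inj₁ refl  = root∈L y∉H′
  ... | inj₂ y∈inv = ∈-++⁺ˡ y∈inv

  L-unique : Unique L
  L-unique = ++⁺ (dfs-inv-unique dfs) (rootIfUnhandled-unique H′ r) disjoint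
    where
    disjoint : ∀ {y} → ¬ (y ∈ inv × y ∈ rootIfUnhandled H′ r)
    disjoint (y∈inv , y∈) = dfs-inv-fresh dfs y∈inv (here (proj₁ (∈-rootIfUnhandled⁻ H′ r y∈)))

  new⊆visited : ∀ {n} → n ∈ new R → Star (Edge (union G R)) n r → n ∈ vis
  new⊆visited n∈new ε = dfs-visited-mono dfs (here refl)
  new⊆visited n∈new ((_ , m∈ , n↝m) ◅ m↝⋆r) with new? _
  ... | inj₂ m∉new = ⊥-elim (new∉G n∈new (fanin-closed (∈U-old m∈ m∉new) (fanin-old m∉new n↝m)))
  ... | inj₁ m∈new
    with visited-explored (new⊆visited m∈new m↝⋆r) (fanins-redirect⁺ x R _ n↝m (new-unhandled n∈new ∘ here))
  ...   | inj₁ n∈H′  = ⊥-elim (new-unhandled n∈new n∈H′)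
  ...   | inj₂ n∈vis = n∈vis

  new⊆L : ∀ {n} → n ∈ new R → n ∈ L
  new⊆L n∈new = visited⊆L (new⊆visited n∈new (All.lookup rooted n∈new)) (new-unhandled n∈new)

  edge-G : ∀ {a b} → b ∈ V G′ → b ∉ new R → Fanin (union G R) a b → Edge G a b
  edge-G b∈G′ b∉new a↝b = fanin-closed b∈G a↝b′ , b∈G , a↝b′
    where
    b∈G  = ∈U-old (proj₁ (∈G′⁻ b∈G′)) b∉new
    a↝b′ = fanin-old b∉new a↝b

  edge-old-target : ∀ {a b} → Edge G′ a b → b ∉ new R → (a ≡ r × Edge G x b) ⊎ (¬ a ≡ x × Edge G a b)
  edge-old-target (_ , b∈G′ , a↝b) b∉new with fanins-redirect⁻ x R (gate (union G R) _) a↝b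
  ... | inj₁ (a≡r , x↝b)  = inj₁ (a≡r , edge-G b∈G′ b∉new x↝b)
  ... | inj₂ (a≢x , a↝b′) = inj₂ (a≢x , edge-G b∈G′ b∉new a↝b′)

  stayed : List ℕ
  stayed = filter (_∉? L) (filter (_∉? D) rest)

  reinsert-L : reinsert [] (filter (_∉? D) rest) L ≡ L ++ stayed
  reinsert-L = reinsert-≡ [] _ L L-unique (All.tabulate λ _ ())

  stayed∉L : ∀ {n} → n ∈ stayed → n ∉ L
  stayed∉L = proj₂ ∘ ∈-filter⁻ (_∉? L) {xs = filter (_∉? D) rest}

  stayed-unhandled : ∀ {n} → n ∈ stayed → n ∉ H′
  stayed-unhandled n∈ = rest-unhandled I (proj₁ (∈-filter⁻ (_∉? D) (proj₁ (∈-filter⁻ (_∉? L) n∈))))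

  stayed-complete : ∀ {n} → n ∈ V G′ → n ∉ H′ → n ∉ L → n ∈ stayed
  stayed-complete n∈G′ n∉H′ n∉L with ∈G′⁻ n∈G′
  ... | n∈U , n∉D with new? _
  ...   | inj₁ n∈new = ⊥-elim (n∉L (new⊆L n∈new))
  ...   | inj₂ n∉new =
    ∈-filter⁺ (_∉? L) (∈-filter⁺ (_∉? D) (unhandled-in-rest I (∈U-old n∈U n∉new) n∉H′) n∉D) n∉L

  G′-fanin-closed : ∀ {n w} → n ∈ V G′ → Fanin G′ w n → w ∈ V G′
  G′-fanin-closed {n} {w} n∈G′ w↝n = ∈-filter⁺ (_∉? D) w∈U w∉D
    where
    n∈U = proj₁ (∈G′⁻ n∈G′)
    w∈U = U-fanin-closed n∈U w↝n
    w∉D : w ∉ D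
    w∉D w∈D with proj₁ (dead w) w∈D
    ... | dead-root with fanins-redirect⁻ x R (gate (union G R) n) w↝n
    ...   | inj₁ (x≡r , _) = root≢x (sym x≡r)
    ...   | inj₂ (x≢x , _) = x≢x refl
    w∉D w∈D | dead-cascade _ _ _ _ fanouts-dead =
      proj₂ (∈G′⁻ n∈G′) (proj₂ (dead n) (fanouts-dead n (w∈U , n∈U , w↝n)))

  order-unique′ : Unique (L ++ stayed)
  order-unique′ = ++⁺ L-unique (filter⁺ (_∉? L) (filter⁺ (_∉? D) (rest-unique I)))
                      (λ (y∈L , y∈stayed) → stayed∉L y∈stayed y∈L)

  order-unhandled′ : ∀ {n} → n ∈ L ++ stayed → n ∉ H′
  order-unhandled′ n∈ with ∈-++⁻ L n∈
  ... | inj₂ n∈stayed = stayed-unhandled n∈stayed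
  ... | inj₁ n∈L with ∈L⁻ n∈L
  ...   | inj₁ n∈inv         = dfs-inv-unhandled dfs n∈inv
  ...   | inj₂ (refl , r∉H′) = r∉H′

  unhandled-ordered′ : ∀ {n} → n ∈ V G′ → n ∉ H′ → n ∈ L ++ stayed
  unhandled-ordered′ {n} n∈G′ n∉H′ with n ∈? L
  ... | yes n∈L = ∈-++⁺ˡ n∈L
  ... | no n∉L  = ∈-++⁺ʳ L (stayed-complete n∈G′ n∉H′ n∉L)

  fanout-unhandled′ : ∀ {a b} → Edge G′ a b → a ∉ H′ → b ∉ H′
  fanout-unhandled′ (_ , b∈G′ , _) _ (here refl) = proj₂ (∈G′⁻ b∈G′) x∈D
  fanout-unhandled′ {b = b} e a∉H′ (there b∈H) with new? b
  ... | inj₁ b∈new = new-unhandled b∈new (there b∈H)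
  ... | inj₂ b∉new with edge-old-target e b∉new
  ...   | inj₁ (_ , x→b)   = fanout-unhandled x→b (head-unhandled I) b∈H
  ...   | inj₂ (_ , a→b)   = fanout-unhandled a→b (∉-∷⁻ a∉H′) b∈H

  explored-fanin-in-inv : ∀ {a} → a ∉ H′ → ¬ a ≡ r → a ∈ H′ ⊎ a ∈ vis → a ∈ inv
  explored-fanin-in-inv a∉H′ _   (inj₁ a∈H′)  = ⊥-elim (a∉H′ a∈H′)
  explored-fanin-in-inv _    a≢r (inj₂ a∈vis) with visited⁻ a∈vis
  ... | inj₁ a≡r   = ⊥-elim (a≢r a≡r)
  ... | inj₂ a∈inv = a∈inv

  edge-into-L-ordered : ∀ {a b} → Edge G′ a b → a ∉ H′ → b ∈ L → Precedes L a b
  edge-into-L-ordered (_ , _ , a↝b) a∉H′ b∈L with ∈L⁻ b∈L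
  ... | inj₁ b∈inv = precedes-++⁺ˡ inv _ (dfs-inv-topological dfs-cycle-free dfs b∈inv a∈inv a↝b)
    where
    a∈inv = explored-fanin-in-inv a∉H′ (λ { refl → root-acyclic (a↝b ◅⁺ inv-upstream b∈inv) })
                                  (dfs-fanins-explored dfs b∈inv a↝b)
  ... | inj₂ (refl , r∉H′) = precedes-++⁺ inv _ a∈inv (∈-rootIfUnhandled⁺ r∉H′)
    where
    a∈inv = explored-fanin-in-inv a∉H′ (λ { refl → root-acyclic ⁺[ a↝b ] }) (dfs-todo-explored dfs a↝b)

  edge-into-stayed-ordered : ∀ {a b} → Edge G′ a b → a ∉ H′ → b ∉ H′ → a ∉ L → b ∉ L →
                             Precedes stayed a b
  edge-into-stayed-ordered e a∉H′ b∉H′ a∉L b∉L with new? _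
  ... | inj₁ b∈new = ⊥-elim (b∉L (new⊆L b∈new))
  ... | inj₂ b∉new with edge-old-target e b∉new
  ...   | inj₁ (refl , _)  = ⊥-elim (a∉L (root∈L a∉H′))
  ...   | inj₂ (a≢x , a→b) =
    precedes-filter⁺ (_∉? L) _
      (precedes-filter⁺ (_∉? D) rest (edge-ordered-rest I a→b a≢x (∉-∷⁻ a∉H′) (∉-∷⁻ b∉H′))
                        (proj₂ (∈G′⁻ (proj₁ e))) (proj₂ (∈G′⁻ (proj₁ (proj₂ e)))))
      a∉L b∉L

  edge-ordered′ : ∀ {a b} → Edge G′ a b → a ∉ H′ → b ∉ H′ → Precedes (L ++ stayed) a b
  edge-ordered′ {a} {b} e a∉H′ b∉H′ with b ∈? L | a ∈? L
  ... | yes b∈L | _       = precedes-++⁺ˡ L _ (edge-into-L-ordered e a∉H′ b∈L)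
  ... | no b∉L  | yes a∈L = precedes-++⁺ L _ a∈L (stayed-complete (proj₁ (proj₂ e)) b∉H′ b∉L)
  ... | no b∉L  | no a∉L  = precedes-++⁺ʳ L _ (edge-into-stayed-ordered e a∉H′ b∉H′ a∉L b∉L)

  invariant-replace : Invariant ⟨ G′ , reinsert [] (filter (_∉? D) rest) L , H′ ⟩
  invariant-replace rewrite reinsert-L = record
    { fanin-closed      = G′-fanin-closed
    ; order-unique      = order-unique′
    ; order-unhandled   = order-unhandled′
    ; unhandled-ordered = unhandled-ordered′
    ; fanout-unhandled  = fanout-unhandled′
    ; edge-ordered      = edge-ordered′
    }

invariant-step : ∀ {k s s′} → Step k s s′ → Invariant s → Invariant s′
invariant-step keep                         I = invariant-keep I
invariant-step (replace R D valid dead dfs) I = ReplacementStep.invariant-replace R D valid dead dfs I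

invariant-steps : ∀ {k s s′} → Star (Step k) s s′ → Invariant s → Invariant s′
invariant-steps ε              I = I
invariant-steps (first ◅ rest) I = invariant-steps rest (invariant-step first I)

path-ordered : ∀ {s m n} → Invariant s → m ∉ handled s → n ∉ handled s →
               Path (graph s) m n → Precedes (order s) m n
path-ordered I m∉H n∉H ⁺[ e ]       = Invariant.edge-ordered I e m∉H n∉H
path-ordered I m∉H n∉H (e ⁺∷ y⇝n) =
  precedes-trans order-unique (edge-ordered e m∉H y∉H) (path-ordered I y∉H n∉H y⇝n)
  where
  open Invariant I
  y∉H = fanout-unhandled e m∉H

theorem2 : ∀ (k : ℕ) (G₀ : AIG) (T₀ : List ℕ) (s : State) →
           WF G₀ → T₀ ↭ V G₀ → (∀ m n → Path G₀ m n → Precedes T₀ m n) →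
           Star (Step k) ⟨ G₀ , T₀ , [] ⟩ s →
           ∀ m n → m ∈ V (graph s) → m ∉ handled s →
           n ∈ V (graph s) → n ∉ handled s →
           Path (graph s) m n → Precedes (order s) m n
theorem2 k G₀ T₀ s wf T₀↭V₀ paths-ordered steps m n _ m∉H _ n∉H =
  path-ordered (invariant-steps steps (invariant-initial wf T₀↭V₀ paths-ordered)) m∉H n∉H
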